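{- There is an absolute constant $c>0$ such that every (planar) graph $G$ that contains as a subgraph a wheel on $\nu$ vertices satisfies $mcc_2(G) \geq c\sqrt{\nu}$, i.e., $mcc_2(G) = \Omega(\sqrt{\nu})$.
   Context: A wheel on $n$ vertices consists of $n-1$ vertices forming a cycle (the rim) and one further central vertex adjacent to every rim vertex. For a graph $G$, a $2$-coloring is an arbitrary assignment of one of two colors to each vertex (adjacent vertices may share a color); a monochromatic connected component is a connected component of the subgraph induced by one color class; $mcc_2(G)$ is the smallest $m$ such that some $2$-coloring of $G$ has all monochromatic connected components of at most $m$ vertices. -}

module Defs where

open import Data.Nat using (ℕ; zero; suc; _≤_; _<_; _*_)
open import Data.Nat.Properties using (_<?_)
open import Data.Fin using (Fin; toℕ; fromℕ<)
open import Data.Bool using (Bool)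
open import Data.Product using (Σ; Σ-syntax; _×_)
open import Relation.Nullary using (¬_; yes; no)
open import Relation.Binary.PropositionalEquality using (_≡_)
open import Function.Definitions using (Injective)
open import Level using (0ℓ)

record Graph (n : ℕ) : Set₁ where
  field
    Adj     : Fin n → Fin n → Set
    sym     : ∀ {u v} → Adj u v → Adj v u
    irrefl  : ∀ {u} → ¬ Adj u u
open Graph public

cycSucc : ∀ {k} → Fin k → Fin k
cycSucc {suc k} i with suc (toℕ i) <? suc k
... | yes p = fromℕ< p
... | no _  = Fin.zero

record Wheel {n : ℕ} (G : Graph n) (k : ℕ) : Set where
  field
    rim-size : 3 ≤ k
    hub      : Fin n
    rim      : Fin k → Fin n
    rim-inj  : Injective _≡_ _≡_ rim
    hub∉rim  : ∀ i → ¬ (hub ≡ rim i)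
    spoke    : ∀ i → Adj G hub (rim i)
    cycle    : ∀ i → Adj G (rim i) (rim (cycSucc i))

ContainsWheel : ∀ {n} → Graph n → ℕ → Set
ContainsWheel G ν = Σ[ k ∈ ℕ ] (ν ≡ suc k × Wheel G k)

Coloring : ℕ → Set
Coloring n = Fin n → Bool

data MonoReach {n : ℕ} (G : Graph n) (col : Coloring n) (v : Fin n) : Fin n → Set where
  here : MonoReach G col v v
  step : ∀ {u w} → MonoReach G col v u → Adj G u w → col w ≡ col v → MonoReach G col v w

AllMCCAtMost : ∀ {n} → Graph n → Coloring n → ℕ → Set
AllMCCAtMost {n} G col m =
  ∀ (v : Fin n) (k : ℕ) (f : Fin k → Fin n) → Injective _≡_ _≡_ f →
  (∀ i → MonoReach G col v (f i)) → k ≤ m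

IsMcc2 : ∀ {n} → Graph n → ℕ → Set
IsMcc2 {n} G m =
  (Σ[ col ∈ Coloring n ] AllMCCAtMost G col m) ×
  (∀ (m′ : ℕ) (col : Coloring n) → AllMCCAtMost G col m′ → m ≤ m′)

-- Let every monochromatic component have at most m vertices, and split the
-- rim of the wheel into consecutive windows of m + 1 vertices. A window
-- avoiding the hub's colour would be a monochromatic path on m + 1 vertices,
-- so every window contains a rim vertex of the hub's colour, which is joined
-- to the hub by a spoke. With m disjoint windows the hub's component would
-- have m + 1 vertices; hence the rim has fewer than m (m + 1) vertices and
-- ν ≤ m (m + 1) ≤ 2 m².
module Submission where

open import Defs
open import Data.Nat using (ℕ; zero; suc; _+_; _*_; _≤_; _<_; z≤n; s≤s; s≤s⁻¹; NonZero; >-nonZero)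
open import Data.Nat.Properties
open import Data.Nat.DivMod
open import Data.Nat.Divisibility using (n∣m*n)
open import Data.Fin using (Fin; toℕ; fromℕ<)
open import Data.Fin.Properties using (toℕ-injective; toℕ<n; toℕ-fromℕ<; any?)
open import Data.Vec.Functional using (_∷_)
open import Data.Bool using (not)
open import Data.Bool.Properties using (¬-not) renaming (_≟_ to _≟ᵇ_)
open import Data.Product using (Σ-syntax; ∃-syntax; _×_; _,_; proj₁; proj₂)
open import Relation.Nullary using (¬_; yes; no; contradiction)
open import Relation.Binary.PropositionalEquality as ≡
  using (_≡_; _≢_; refl; cong; cong₂; subst; trans; module ≡-Reasoning)
open import Function.Definitions using (Injective)

[m*n+o]/n≡m : ∀ m n {o} .{{_ : NonZero n}} → o < n → (m * n + o) / n ≡ m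
[m*n+o]/n≡m m n {o} o<n = begin
  (m * n + o) / n    ≡⟨ +-distrib-/-∣ˡ o (n∣m*n m) ⟩
  m * n / n + o / n  ≡⟨ cong₂ _+_ (m*n/n≡m m n) (m<n⇒m/n≡0 o<n) ⟩
  m + 0              ≡⟨ +-identityʳ m ⟩
  m                  ∎
  where open ≡-Reasoning

∷-injective-fresh : ∀ {A : Set} {l} {x : A} {f : Fin l → A} →
                    (∀ i → x ≢ f i) → Injective _≡_ _≡_ f → Injective _≡_ _≡_ (x ∷ f)
∷-injective-fresh fresh inj {Fin.zero}  {Fin.zero}  _ = refl
∷-injective-fresh fresh inj {Fin.zero}  {Fin.suc j} e = contradiction e (fresh j)
∷-injective-fresh fresh inj {Fin.suc i} {Fin.zero}  e = contradiction (≡.sym e) (fresh i)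
∷-injective-fresh fresh inj {Fin.suc i} {Fin.suc j} e = cong Fin.suc (inj e)

toℕ-cycSucc : ∀ {k} (i : Fin (suc k)) → toℕ (cycSucc i) ≡ suc (toℕ i) % suc k
toℕ-cycSucc {k} i with suc (toℕ i) <? suc k
... | yes p = trans (toℕ-fromℕ< p) (≡.sym (m<n⇒m%n≡m p))
... | no ¬p = ≡.sym (trans (cong (_% suc k) (≤-antisym (toℕ<n i) (≮⇒≥ ¬p))) (n%n≡0 (suc k)))

cycSucc-mod : ∀ k .{{_ : NonZero k}} i → cycSucc (i mod k) ≡ suc i mod k
cycSucc-mod k@(suc _) i = toℕ-injective (begin
  toℕ (cycSucc (i mod k))        ≡⟨ toℕ-cycSucc (i mod k) ⟩
  suc (toℕ (i mod k)) % k        ≡⟨ cong (λ r → suc r % k) (toℕ-fromℕ< _) ⟩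
  suc (i % k) % k                ≡⟨ [m+kn]%n≡m%n (suc (i % k)) (i / k) k ⟨
  (suc (i % k) + i / k * k) % k  ≡⟨ cong (λ r → suc r % k) (m≡m%n+[m/n]*n i k) ⟨
  suc i % k                      ≡⟨ toℕ-fromℕ< _ ⟨
  toℕ (suc i mod k)              ∎)
  where open ≡-Reasoning

mod-injective-< : ∀ k .{{_ : NonZero k}} {i j} → i < k → j < k → i mod k ≡ j mod k → i ≡ j
mod-injective-< k {i} {j} i<k j<k e = begin
  i              ≡⟨ m<n⇒m%n≡m i<k ⟨
  i % k          ≡⟨ toℕ-fromℕ< _ ⟨
  toℕ (i mod k)  ≡⟨ cong toℕ e ⟩
  toℕ (j mod k)  ≡⟨ toℕ-fromℕ< _ ⟩
  j % k          ≡⟨ m<n⇒m%n≡m j<k ⟩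
  j              ∎
  where open ≡-Reasoning

IsWalk : ∀ {n} → Graph n → (ℕ → Fin n) → Set
IsWalk G w = ∀ i → Adj G (w i) (w (suc i))

module _ {n} {G : Graph n} {w : ℕ → Fin n} (walk : IsWalk G w) where

  walk-shift : ∀ s → IsWalk G (λ i → w (s + i))
  walk-shift s i = subst (Adj G (w (s + i))) (cong w (≡.sym (+-suc s i))) (walk (s + i))

  walk-monoReach : ∀ {col} l → (∀ t → t ≤ l → col (w t) ≡ col (w 0)) →
                   MonoReach G col (w 0) (w l)
  walk-monoReach zero    _    = here
  walk-monoReach (suc l) same =
    step (walk-monoReach l (λ t t≤l → same t (m≤n⇒m≤1+n t≤l))) (walk l) (same (suc l) ≤-refl)

  monoWalk-< : ∀ {col m} → AllMCCAtMost G col m → ∀ l →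
               Injective _≡_ _≡_ (λ (t : Fin (suc l)) → w (toℕ t)) →
               (∀ t → t ≤ l → col (w t) ≡ col (w 0)) → l < m
  monoWalk-< small l inj same = small (w 0) (suc l) (λ t → w (toℕ t)) inj
    (λ t → walk-monoReach (toℕ t) (λ u u≤t → same u (≤-trans u≤t (s≤s⁻¹ (toℕ<n t)))))

module WheelRim {n} {G : Graph n} {k} (W : Wheel G k) where
  open Wheel W

  instance
    k-nonZero : NonZero k
    k-nonZero = >-nonZero (≤-trans (s≤s z≤n) rim-size)

  rimAt : ℕ → Fin n
  rimAt i = rim (i mod k)

  rimAt-walk : IsWalk G rimAt
  rimAt-walk i = subst (Adj G (rimAt i)) (cong rim (cycSucc-mod k i)) (cycle (i mod k))

  rimAt-injective-< : ∀ {i j} → i < k → j < k → rimAt i ≡ rimAt j → i ≡ j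
  rimAt-injective-< i<k j<k e = mod-injective-< k i<k j<k (rim-inj e)

module _ {n} {G : Graph n} {col : Coloring n} {m} (small : AllMCCAtMost G col m)
         {k} (W : Wheel G k) where
  open Wheel W
  open WheelRim W

  window-< : ∀ {s t} → s + m < k → t ≤ m → s + t < k
  window-< {s} s+m<k t≤m = ≤-<-trans (+-monoʳ-≤ s t≤m) s+m<k

  window-meets-hubColour : ∀ s → s + m < k → ∃[ t ] (t ≤ m × col (rimAt (s + t)) ≡ col hub)
  window-meets-hubColour s s+m<k
    with any? {P = λ (t : Fin (suc m)) → col (rimAt (s + toℕ t)) ≡ col hub}
              (λ t → col (rimAt (s + toℕ t)) ≟ᵇ col hub)
  ... | yes (t , hubColoured) = toℕ t , s≤s⁻¹ (toℕ<n t) , hubColoured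
  ... | no none = contradiction (monoWalk-< (walk-shift {G = G} {w = rimAt} rimAt-walk s) small m inj same) (n≮n m)
    where
    avoids : ∀ t → t ≤ m → col (rimAt (s + t)) ≡ not (col hub)
    avoids t t≤m = ¬-not λ e → none (fromℕ< (s≤s t≤m) ,
      subst (λ u → col (rimAt (s + u)) ≡ col hub) (≡.sym (toℕ-fromℕ< (s≤s t≤m))) e)
    same : ∀ t → t ≤ m → col (rimAt (s + t)) ≡ col (rimAt (s + 0))
    same t t≤m = trans (avoids t t≤m) (≡.sym (avoids 0 z≤n))
    inj : Injective _≡_ _≡_ (λ (t : Fin (suc m)) → rimAt (s + toℕ t))
    inj {t} {u} e = toℕ-injective (+-cancelˡ-≡ s _ _
      (rimAt-injective-< (window-< s+m<k (s≤s⁻¹ (toℕ<n t))) (window-< s+m<k (s≤s⁻¹ (toℕ<n u))) e))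

  block-window : m * suc m ≤ k → (j : Fin m) → toℕ j * suc m + m < k
  block-window big j = begin-strict
    toℕ j * suc m + m      <⟨ +-monoʳ-< (toℕ j * suc m) (n<1+n m) ⟩
    toℕ j * suc m + suc m  ≡⟨ +-comm (toℕ j * suc m) (suc m) ⟩
    suc (toℕ j) * suc m    ≤⟨ *-monoˡ-≤ (suc m) (toℕ<n j) ⟩
    m * suc m              ≤⟨ big ⟩
    k                      ∎
    where open ≤-Reasoning

  rim-≱ : ¬ (m * suc m ≤ k)
  rim-≱ big = n≮n m (small hub (suc m) (hub ∷ pick) hub∷pick-injective reach)
    where
    hubColoured : ∀ j → ∃[ t ] (t ≤ m × col (rimAt (toℕ j * suc m + t)) ≡ col hub)
    hubColoured j = window-meets-hubColour (toℕ j * suc m) (block-window big j)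
    offset : Fin m → ℕ
    offset j = proj₁ (hubColoured j)
    offset-≤ : ∀ j → offset j ≤ m
    offset-≤ j = proj₁ (proj₂ (hubColoured j))
    pick : Fin m → Fin n
    pick j = rimAt (toℕ j * suc m + offset j)
    pick-injective : Injective _≡_ _≡_ pick
    pick-injective {i} {j} e = toℕ-injective (begin
      toℕ i                               ≡⟨ [m*n+o]/n≡m (toℕ i) (suc m) (s≤s (offset-≤ i)) ⟨
      (toℕ i * suc m + offset i) / suc m  ≡⟨ cong (_/ suc m) (rimAt-injective-<
                                               (window-< (block-window big i) (offset-≤ i))
                                               (window-< (block-window big j) (offset-≤ j)) e) ⟩
      (toℕ j * suc m + offset j) / suc m  ≡⟨ [m*n+o]/n≡m (toℕ j) (suc m) (s≤s (offset-≤ j)) ⟩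
      toℕ j                               ∎)
      where open ≡-Reasoning
    hub∷pick-injective : Injective _≡_ _≡_ (hub ∷ pick)
    hub∷pick-injective = ∷-injective-fresh (λ j → hub∉rim _) pick-injective
    reach : ∀ i → MonoReach G col hub ((hub ∷ pick) i)
    reach Fin.zero    = here
    reach (Fin.suc j) = step here (spoke _) (proj₂ (proj₂ (hubColoured j)))

m≤m*m : ∀ m → m ≤ m * m
m≤m*m zero    = z≤n
m≤m*m (suc m) = m≤m*n (suc m) (suc m)

corollary1 : Σ[ d ∈ ℕ ] (1 ≤ d × (∀ (n : ℕ) (G : Graph n) (ν m : ℕ) → ContainsWheel G ν → IsMcc2 G m → ν ≤ d * (m * m)))
corollary1 = 2 , s≤s z≤n , bound
  where
  bound : ∀ (n : ℕ) (G : Graph n) (ν m : ℕ) → ContainsWheel G ν → IsMcc2 G m → ν ≤ 2 * (m * m)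
  bound n G ν m (k , refl , W) ((col , small) , _) = begin
    suc k              ≤⟨ ≰⇒> (rim-≱ small W) ⟩
    m * suc m          ≡⟨ *-suc m m ⟩
    m + m * m          ≤⟨ +-monoˡ-≤ (m * m) (m≤m*m m) ⟩
    m * m + m * m      ≡⟨ cong (m * m +_) (+-identityʳ (m * m)) ⟨
    2 * (m * m)        ∎
    where open ≤-Reasoning
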